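{- For every $m\ge0$ and every permutation $\sigma\in S_m$ there is a polynomial $P_\sigma$ in the variables $N,C_1,C_2,C_3,\dots$ (depending on $\sigma$ only) such that for every $N\ge1$, \[ \sum_{i_1,\dots,i_m=1}^N E_{i_1 i_{\sigma(1)}}E_{i_2 i_{\sigma(2)}}\cdots E_{i_m i_{\sigma(m)}} \;=\; P_\sigma\big(N, C_1^{(N)},C_2^{(N)},\dots\big)\quad\text{in } U(\mathfrak{gl}_N), \] where $C_k^{(N)}=\sum_{i_1,\dots,i_k=1}^N E_{i_1i_2}E_{i_2i_3}\cdots E_{i_ki_1}\in U(\mathfrak{gl}_N)$.
   Context: $\mathfrak{gl}_N$ is the Lie algebra of all complex $N\times N$ matrices with the commutator bracket, $E_{ij}$ are its matrix units, and $U(\mathfrak{gl}_N)$ is its universal enveloping algebra. The elements $C_k^{(N)}$, $k\ge1$, are the Casimir elements. -}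

module Defs where

open import Data.Nat as ℕ using (ℕ; zero; suc; _<?_; s≤s)
open import Data.Integer using (+_)
open import Data.Rational using (ℚ; 0ℚ; 1ℚ; -_; _/_) renaming (_+_ to _+ℚ_; _*_ to _*ℚ_)
open import Data.Fin using (Fin; zero; suc; toℕ; fromℕ<; _≟_)
open import Data.Fin.Permutation using (Permutation′; _⟨$⟩ʳ_)
open import Data.List using (List; []; _∷_; map; concatMap; foldr; [_])
open import Data.List using () renaming (allFin to allFinL)
open import Data.Vec.Functional as VF using ()
open import Relation.Nullary using (yes; no)

infixl 6 _⊕_
infixl 7 _⊗_

data Tm (N : ℕ) : Set where
  E   : Fin N → Fin N → Tm N
  con : ℚ → Tm N
  _⊕_ : Tm N → Tm N → Tm N
  _⊗_ : Tm N → Tm N → Tm N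

δ : ∀ {N} → Fin N → Fin N → ℚ
δ j k with j ≟ k
... | yes _ = 1ℚ
... | no  _ = 0ℚ

-- U(gl_N) over ℚ: the free algebra modulo the congruence generated by
-- the associative unital ℚ-algebra axioms and the relations
--   E i j E k l - E k l E i j = δ j k E i l - δ l i E k j.

infix 4 _≈U_

data _≈U_ {N : ℕ} : Tm N → Tm N → Set where
  ≈refl  : ∀ {x} → x ≈U x
  ≈sym   : ∀ {x y} → x ≈U y → y ≈U x
  ≈trans : ∀ {x y z} → x ≈U y → y ≈U z → x ≈U z
  ⊕-cong : ∀ {x x′ y y′} → x ≈U x′ → y ≈U y′ → x ⊕ y ≈U x′ ⊕ y′
  ⊗-cong : ∀ {x x′ y y′} → x ≈U x′ → y ≈U y′ → x ⊗ y ≈U x′ ⊗ y′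
  ⊕-assoc : ∀ x y z → (x ⊕ y) ⊕ z ≈U x ⊕ (y ⊕ z)
  ⊕-comm  : ∀ x y → x ⊕ y ≈U y ⊕ x
  ⊕-idˡ   : ∀ x → con 0ℚ ⊕ x ≈U x
  ⊕-invˡ  : ∀ x → con (- 1ℚ) ⊗ x ⊕ x ≈U con 0ℚ
  ⊗-assoc : ∀ x y z → (x ⊗ y) ⊗ z ≈U x ⊗ (y ⊗ z)
  ⊗-idˡ   : ∀ x → con 1ℚ ⊗ x ≈U x
  ⊗-idʳ   : ∀ x → x ⊗ con 1ℚ ≈U x
  distribˡ : ∀ x y z → x ⊗ (y ⊕ z) ≈U x ⊗ y ⊕ x ⊗ z
  distribʳ : ∀ x y z → (y ⊕ z) ⊗ x ≈U y ⊗ x ⊕ z ⊗ x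
  con-+   : ∀ a b → con a ⊕ con b ≈U con (a +ℚ b)
  con-*   : ∀ a b → con a ⊗ con b ≈U con (a *ℚ b)
  con-central : ∀ a x → con a ⊗ x ≈U x ⊗ con a
  comm-rel : ∀ i j k l →
    E i j ⊗ E k l ≈U E k l ⊗ E i j ⊕ con (δ j k) ⊗ E i l ⊕ con (- δ l i) ⊗ E k j

sumU : ∀ {N} → List (Tm N) → Tm N
sumU = foldr _⊕_ (con 0ℚ)

prodU : ∀ {N} (m : ℕ) → (Fin m → Tm N) → Tm N
prodU zero    x = con 1ℚ
prodU (suc m) x = x zero ⊗ prodU m (λ r → x (suc r))

allIdx : (m N : ℕ) → List (Fin m → Fin N)
allIdx zero    N = [ (λ ()) ]
allIdx (suc m) N = concatMap (λ i → map (λ f → i VF.∷ f) (allIdx m N)) (allFinL N)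

permSum : (N m : ℕ) → Permutation′ m → Tm N
permSum N m σ = sumU (map (λ i → prodU m (λ r → E (i r) (i (σ ⟨$⟩ʳ r)))) (allIdx m N))

cyc : ∀ {k} → Fin (suc k) → Fin (suc k)
cyc {k} r with suc (toℕ r) <? suc k
... | yes p = fromℕ< p
... | no  _ = zero

casimir : (N k : ℕ) → Tm N
casimir N zero    = con 0ℚ   -- unused (C_k only for k ≥ 1)
casimir N (suc k) = sumU (map (λ i → prodU (suc k) (λ r → E (i r) (i (cyc r)))) (allIdx (suc k) N))

data Poly : Set where
  varN  : Poly
  varC  : ℕ → Poly        -- varC k stands for C_{k+1}
  const : ℚ → Poly
  _+P_  : Poly → Poly → Poly
  _*P_  : Poly → Poly → Poly

evalP : (N : ℕ) → Poly → Tm N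
evalP N varN      = con (+ N / 1)
evalP N (varC k)  = casimir N (suc k)
evalP N (const a) = con a
evalP N (p +P q)  = evalP N p ⊕ evalP N q
evalP N (p *P q)  = evalP N p ⊗ evalP N q

{-# OPTIONS --safe #-}
-- Write S_f = Σ_ρ Π_r E (ρ r) (ρ (f r)) for an injective f on m positions, so that the sum
-- of the theorem is S_σ and C_k = S_cyc.  Exchanging two adjacent factors by
-- [E_ab, E_cd] = δ_bc E_ad − δ_da E_cb turns S_f into S_{τfτ}, τ the transposition of the two
-- positions, plus two contracted sums.  Summing out the index tied by the Kronecker delta, a
-- contracted sum is S_g for a permutation g of m − 1 positions, times N when the delta ties an
-- index to itself.  Such exchanges move the cycle of f through position 0 to the
-- positions 0 ↦ 1 ↦ ⋯ ↦ k ↦ 0, and then S_f = C_{k+1} S_g with g the restriction of f to the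
-- remaining positions.

module Submission where

open import Defs
open import Data.Nat using (ℕ; _≤_)
open import Data.Product using (Σ)
open import Data.Fin.Permutation using (Permutation′)

open import Level using (0ℓ)
open import Algebra.Bundles using (Ring)
open import Algebra.Structures using (IsRing)
import Algebra.Properties.CommutativeSemigroup as CommutativeSemigroupProperties
open import Data.Nat as ℕ using (zero; suc; _<_; _∸_; z≤n; s≤s)
import Data.Nat.Properties as ℕP
open import Data.Nat.Induction using (<-rec)
open import Data.Nat.Coprimality using (1-coprimeTo) renaming (sym to coprime-sym)
open import Data.Integer using (+_)
import Data.Integer as ℤ
open import Data.Integer.Tactic.RingSolver using (solve-∀)
open import Data.Rational using (ℚ; mkℚ; 0ℚ; 1ℚ; -_; _/_) renaming (_+_ to _+ℚ_; _*_ to _*ℚ_)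
import Data.Rational.Properties as ℚP
open import Algebra.Properties.Ring ℚP.+-*-ring using (-1*x≈-x)
import Data.Rational.Unnormalised as ℚᵘ
import Data.Rational.Unnormalised.Properties as ℚᵘP
open import Data.Fin as Fin using (Fin; zero; suc; toℕ; fromℕ<; inject₁; punchIn; punchOut; _↑ˡ_; _↑ʳ_; _≟_)
import Data.Fin.Properties as FinP
open import Data.Fin.Permutation using (_⟨$⟩ʳ_)
open import Data.List using (List; []; _∷_; _++_; map; concatMap; allFin)
import Data.List.Properties as ListP
open import Data.Vec.Functional as Vector using (Vector; insertAt)
open import Data.Vec.Functional.Properties using (∷-cong; insertAt-lookup; insertAt-punchIn; lookup-++ˡ; lookup-++ʳ)
open import Data.Product using (_,_; proj₁; proj₂; _×_; map₂)
open import Data.Sum using (inj₁; inj₂)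
open import Data.Empty using (⊥)
open import Function using (_∘_; id)
open import Function.Bundles using (Injection)
open import Function.Definitions using (Injective)
open import Function.Properties.Inverse using (↔⇒↣)
open import Relation.Binary.PropositionalEquality
  using (_≡_; _≢_; refl; sym; trans; cong; cong₂; subst; _≗_; module ≡-Reasoning)
open import Relation.Nullary using (Dec; yes; no; contradiction)

[1+n]/1≡1+n/1 : ∀ n → + suc n / 1 ≡ 1ℚ +ℚ (+ n / 1)
[1+n]/1≡1+n/1 n
  rewrite ℚP.normalize-coprime (coprime-sym (1-coprimeTo n))
        | ℚP.normalize-coprime (coprime-sym (1-coprimeTo (suc n)))
  = ℚP.toℚᵘ-injective (ℚᵘP.≃-trans (ℚᵘ.*≡* (numerators (+ n)))
      (ℚᵘP.≃-sym (ℚP.toℚᵘ-homo-+ 1ℚ (mkℚ (+ n) 0 (coprime-sym (1-coprimeTo n))))))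
  where
  numerators : ∀ (x : ℤ.ℤ) → (+ 1 ℤ.+ x) ℤ.* + 1 ≡ (+ 1 ℤ.* + 1 ℤ.+ x ℤ.* + 1) ℤ.* + 1
  numerators = solve-∀

δ-refl : ∀ {N} (j : Fin N) → δ j j ≡ 1ℚ
δ-refl j with j ≟ j
... | yes _   = refl
... | no j≢j = contradiction refl j≢j

δ-suc : ∀ {N} (j k : Fin N) → δ (suc j) (suc k) ≡ δ j k
δ-suc j k with j ≟ k
... | yes _ = refl
... | no _  = refl

-- Adjacent transpositions, merging, and removal from a cycle

swapAt : ∀ {m} → Fin m → Fin (suc m) → Fin (suc m)
swapAt zero    zero          = suc zero
swapAt zero    (suc zero)    = zero
swapAt zero    (suc (suc i)) = suc (suc i)
swapAt (suc p) zero          = zero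
swapAt (suc p) (suc i)       = suc (swapAt p i)

swapAt-inject₁ : ∀ {m} (p : Fin m) → swapAt p (inject₁ p) ≡ suc p
swapAt-inject₁ zero    = refl
swapAt-inject₁ (suc p) = cong suc (swapAt-inject₁ p)

swapAt-suc : ∀ {m} (p : Fin m) → swapAt p (suc p) ≡ inject₁ p
swapAt-suc zero    = refl
swapAt-suc (suc p) = cong suc (swapAt-suc p)

swapAt-other : ∀ {m} (p : Fin m) {i} → i ≢ inject₁ p → i ≢ suc p → swapAt p i ≡ i
swapAt-other zero    {zero}          i≢p _    = contradiction refl i≢p
swapAt-other zero    {suc zero}      _ i≢1+p  = contradiction refl i≢1+p
swapAt-other zero    {suc (suc i)}   _ _      = refl
swapAt-other (suc p) {zero}          _ _      = refl
swapAt-other (suc p) {suc i}         i≢p i≢1+p =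
  cong suc (swapAt-other p (i≢p ∘ cong suc) (i≢1+p ∘ cong suc))

swapAt-below : ∀ {m} (p : Fin m) {i : Fin (suc m)} → toℕ i < toℕ p → swapAt p i ≡ i
swapAt-below (suc p) {zero}  _         = refl
swapAt-below (suc p) {suc i} (s≤s i<p) = cong suc (swapAt-below p i<p)

swapAt-involutive : ∀ {m} (p : Fin m) i → swapAt p (swapAt p i) ≡ i
swapAt-involutive zero    zero          = refl
swapAt-involutive zero    (suc zero)    = refl
swapAt-involutive zero    (suc (suc i)) = refl
swapAt-involutive (suc p) zero          = refl
swapAt-involutive (suc p) (suc i)       = cong suc (swapAt-involutive p i)

swapAt-injective : ∀ {m} (p : Fin m) → Injective _≡_ _≡_ (swapAt p)
swapAt-injective p {i} {j} eq =
  trans (sym (swapAt-involutive p i)) (trans (cong (swapAt p) eq) (swapAt-involutive p j))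

punchIn-suc-self : ∀ {m} (p : Fin m) → punchIn (suc p) p ≡ inject₁ p
punchIn-suc-self zero    = refl
punchIn-suc-self (suc p) = cong suc (punchIn-suc-self p)

punchIn-inject₁-self : ∀ {m} (p : Fin m) → punchIn (inject₁ p) p ≡ suc p
punchIn-inject₁-self zero    = refl
punchIn-inject₁-self (suc p) = cong suc (punchIn-inject₁-self p)

punchIn-inject₁≡punchIn-suc : ∀ {m} (p s : Fin m) → s ≢ p → punchIn (inject₁ p) s ≡ punchIn (suc p) s
punchIn-inject₁≡punchIn-suc zero    zero    s≢p = contradiction refl s≢p
punchIn-inject₁≡punchIn-suc zero    (suc s) _   = refl
punchIn-inject₁≡punchIn-suc (suc p) zero    _   = refl
punchIn-inject₁≡punchIn-suc (suc p) (suc s) s≢p =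
  cong suc (punchIn-inject₁≡punchIn-suc p s (s≢p ∘ cong suc))

mergeAt : ∀ {A : Set} {m} → Fin m → (Fin (suc m) → A) → A → Fin m → A
mergeAt zero    x e zero    = e
mergeAt zero    x e (suc s) = x (suc (suc s))
mergeAt (suc p) x e zero    = x zero
mergeAt (suc p) x e (suc s) = mergeAt p (x ∘ suc) e s

mergeAt-≗ : ∀ {A : Set} {m} (p : Fin m) (x : Fin (suc m) → A) e (y : Fin m → A) → e ≡ y p →
  (∀ s → s ≢ p → x (punchIn (suc p) s) ≡ y s) → ∀ s → mergeAt p x e s ≡ y s
mergeAt-≗ zero    x e y e≡yp rest zero    = e≡yp
mergeAt-≗ zero    x e y e≡yp rest (suc s) = rest (suc s) (λ ())
mergeAt-≗ (suc p) x e y e≡yp rest zero    = rest zero (λ ())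
mergeAt-≗ (suc p) x e y e≡yp rest (suc s) =
  mergeAt-≗ p (x ∘ suc) e (y ∘ suc) e≡yp (λ s′ s′≢p → rest (suc s′) (s′≢p ∘ FinP.suc-injective)) s

punchOutOr : ∀ {m} → Fin (suc m) → Fin m → Fin (suc m) → Fin m
punchOutOr v c y with v ≟ y
... | yes _   = c
... | no v≢y = punchOut v≢y

punchOutOr-≡ : ∀ {m} {v y : Fin (suc m)} c → v ≡ y → punchOutOr v c y ≡ c
punchOutOr-≡ {v = v} {y} c v≡y with v ≟ y
... | yes _   = refl
... | no v≢y = contradiction v≡y v≢y

punchOutOr-≢ : ∀ {m} {v y : Fin (suc m)} c (v≢y : v ≢ y) → punchOutOr v c y ≡ punchOut v≢y
punchOutOr-≢ {v = v} {y} c v≢y with v ≟ y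
... | yes v≡y = contradiction v≡y v≢y
... | no _     = FinP.punchOut-cong v refl

-- Remove v from its cycle in μ, renumbering the other positions by punchIn v: the predecessor of
-- v is sent directly to μ v.  The inner default s is never reached when μ is injective.
bypass : ∀ {m} → (Fin (suc m) → Fin (suc m)) → Fin (suc m) → Fin m → Fin m
bypass μ v s = punchOutOr v (punchOutOr v s (μ v)) (μ (punchIn v s))

bypass-entering : ∀ {m} {μ : Fin (suc m) → Fin (suc m)} → Injective _≡_ _≡_ μ → ∀ v {s₁ s₂} →
  v ≡ μ (punchIn v s₁) → v ≢ μ (punchIn v s₂) → bypass μ v s₁ ≢ bypass μ v s₂
bypass-entering {μ = μ} μ-inj v {s₁} {s₂} v≡₁ v≢₂ eq = from-fixedness (v ≟ μ v)
  where
  open ≡-Reasoning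
  from-fixedness : Dec (v ≡ μ v) → ⊥
  from-fixedness (yes v≡μv) = FinP.punchInᵢ≢i v s₁ (μ-inj (trans (sym v≡₁) v≡μv))
  from-fixedness (no v≢μv)  = FinP.punchInᵢ≢i v s₂ (sym (μ-inj (FinP.punchOut-injective v≢μv v≢₂ (begin
    punchOut v≢μv          ≡⟨ punchOutOr-≢ s₁ v≢μv ⟨
    punchOutOr v s₁ (μ v)  ≡⟨ punchOutOr-≡ _ v≡₁ ⟨
    bypass μ v s₁          ≡⟨ eq ⟩
    bypass μ v s₂          ≡⟨ punchOutOr-≢ _ v≢₂ ⟩
    punchOut v≢₂           ∎))))

bypass-injective : ∀ {m} {μ : Fin (suc m) → Fin (suc m)} → Injective _≡_ _≡_ μ → ∀ v →
  Injective _≡_ _≡_ (bypass μ v)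
bypass-injective {μ = μ} μ-inj v {s₁} {s₂} eq = by-cases (v ≟ μ (punchIn v s₁)) (v ≟ μ (punchIn v s₂))
  where
  by-cases : Dec (v ≡ μ (punchIn v s₁)) → Dec (v ≡ μ (punchIn v s₂)) → s₁ ≡ s₂
  by-cases (yes v≡₁) (yes v≡₂) = FinP.punchIn-injective v s₁ s₂ (μ-inj (trans (sym v≡₁) v≡₂))
  by-cases (no v≢₁)  (no v≢₂)  = FinP.punchIn-injective v s₁ s₂ (μ-inj (FinP.punchOut-injective v≢₁ v≢₂
    (trans (sym (punchOutOr-≢ _ v≢₁)) (trans eq (punchOutOr-≢ _ v≢₂)))))
  by-cases (yes v≡₁) (no v≢₂)  = contradiction eq (bypass-entering μ-inj v v≡₁ v≢₂)
  by-cases (no v≢₁)  (yes v≡₂) = contradiction (sym eq) (bypass-entering μ-inj v v≡₂ v≢₁)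

insertAt-punchOut : ∀ {A : Set} {n} (ρ : Vector A n) {v y : Fin (suc n)} (v≢y : v ≢ y) x →
  insertAt ρ v x y ≡ ρ (punchOut v≢y)
insertAt-punchOut ρ {v} v≢y x =
  trans (cong (insertAt ρ v x) (sym (FinP.punchIn-punchOut v≢y))) (insertAt-punchIn ρ v x (punchOut v≢y))

insertAt-punchOutOr : ∀ {A : Set} {n} (ρ : Vector A n) v x c y → (v ≡ y → x ≡ ρ c) →
  insertAt ρ v x y ≡ ρ (punchOutOr v c y)
insertAt-punchOutOr ρ v x c y x≡ρc with v ≟ y
... | yes refl = trans (insertAt-lookup ρ v x) (x≡ρc refl)
... | no v≢y  = insertAt-punchOut ρ v≢y x

-- The ring U(gl_N) and finite sums in it

U-isRing : ∀ {N} → IsRing (_≈U_ {N}) _⊕_ _⊗_ (con (- 1ℚ) ⊗_) (con 0ℚ) (con 1ℚ)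
U-isRing = record
  { +-isAbelianGroup = record
    { isGroup = record
      { isMonoid = record
        { isSemigroup = record
          { isMagma = record
            { isEquivalence = record { refl = ≈refl ; sym = ≈sym ; trans = ≈trans }
            ; ∙-cong        = ⊕-cong
            }
          ; assoc = ⊕-assoc
          }
        ; identity = ⊕-idˡ , λ x → ≈trans (⊕-comm x _) (⊕-idˡ x)
        }
      ; inverse = ⊕-invˡ , λ x → ≈trans (⊕-comm x _) (⊕-invˡ x)
      ; ⁻¹-cong = ⊗-cong ≈refl
      }
    ; comm = ⊕-comm
    }
  ; *-cong     = ⊗-cong
  ; *-assoc    = ⊗-assoc
  ; *-identity = ⊗-idˡ , ⊗-idʳ
  ; distrib    = distribˡ , distribʳ
  }

U-ring : ℕ → Ring 0ℓ 0ℓ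
U-ring N = record { isRing = U-isRing {N} }

module _ {N : ℕ} where
  open Ring (U-ring N) using (setoid; reflexive; zeroˡ; zeroʳ; +-identityʳ; +-commutativeSemigroup)
  open CommutativeSemigroupProperties +-commutativeSemigroup using (interchange)
  open import Relation.Binary.Reasoning.Setoid setoid

  con-⊗-con : ∀ a b (x : Tm N) → con a ⊗ (con b ⊗ x) ≈U con (a *ℚ b) ⊗ x
  con-⊗-con a b x = ≈trans (≈sym (⊗-assoc _ _ _)) (⊗-cong (con-* a b) ≈refl)

  ⊗-con-⊗ : ∀ a (x y : Tm N) → x ⊗ (con a ⊗ y) ≈U con a ⊗ (x ⊗ y)
  ⊗-con-⊗ a x y = begin
    x ⊗ (con a ⊗ y)  ≈⟨ ⊗-assoc _ _ _ ⟨
    (x ⊗ con a) ⊗ y  ≈⟨ ⊗-cong (con-central _ _) ≈refl ⟨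
    (con a ⊗ x) ⊗ y  ≈⟨ ⊗-assoc _ _ _ ⟩
    con a ⊗ (x ⊗ y)  ∎

  ∑ : ∀ {A : Set} → List A → (A → Tm N) → Tm N
  ∑ xs g = sumU (map g xs)

  ∑-cong : ∀ {A : Set} (xs : List A) {g h : A → Tm N} → (∀ x → g x ≈U h x) → ∑ xs g ≈U ∑ xs h
  ∑-cong []       g≈h = ≈refl
  ∑-cong (x ∷ xs) g≈h = ⊕-cong (g≈h x) (∑-cong xs g≈h)

  ∑-zero : ∀ {A : Set} (xs : List A) → ∑ xs (λ _ → con 0ℚ) ≈U con 0ℚ
  ∑-zero []       = ≈refl
  ∑-zero (x ∷ xs) = ≈trans (⊕-cong ≈refl (∑-zero xs)) (⊕-idˡ _)

  ∑-⊕ : ∀ {A : Set} (xs : List A) (g h : A → Tm N) → ∑ xs (λ x → g x ⊕ h x) ≈U ∑ xs g ⊕ ∑ xs h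
  ∑-⊕ []       g h = ≈sym (⊕-idˡ _)
  ∑-⊕ (x ∷ xs) g h = ≈trans (⊕-cong ≈refl (∑-⊕ xs g h)) (interchange _ _ _ _)

  ∑-⊗ˡ : ∀ {A : Set} (xs : List A) y (g : A → Tm N) → ∑ xs (λ x → y ⊗ g x) ≈U y ⊗ ∑ xs g
  ∑-⊗ˡ []       y g = ≈sym (zeroʳ y)
  ∑-⊗ˡ (x ∷ xs) y g = ≈trans (⊕-cong ≈refl (∑-⊗ˡ xs y g)) (≈sym (distribˡ _ _ _))

  ∑-⊗ʳ : ∀ {A : Set} (xs : List A) y (g : A → Tm N) → ∑ xs (λ x → g x ⊗ y) ≈U ∑ xs g ⊗ y
  ∑-⊗ʳ []       y g = ≈sym (zeroˡ y)
  ∑-⊗ʳ (x ∷ xs) y g = ≈trans (⊕-cong ≈refl (∑-⊗ʳ xs y g)) (≈sym (distribʳ _ _ _))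

  ∑-++ : ∀ {A : Set} (xs ys : List A) (g : A → Tm N) → ∑ (xs ++ ys) g ≈U ∑ xs g ⊕ ∑ ys g
  ∑-++ []       ys g = ≈sym (⊕-idˡ _)
  ∑-++ (x ∷ xs) ys g = ≈trans (⊕-cong ≈refl (∑-++ xs ys g)) (≈sym (⊕-assoc _ _ _))

  ∑-concatMap : ∀ {A B : Set} (h : A → List B) (xs : List A) (g : B → Tm N) →
    ∑ (concatMap h xs) g ≈U ∑ xs (λ x → ∑ (h x) g)
  ∑-concatMap h []       g = ≈refl
  ∑-concatMap h (x ∷ xs) g = ≈trans (∑-++ (h x) _ g) (⊕-cong ≈refl (∑-concatMap h xs g))

  ∑-map : ∀ {A B : Set} (h : A → B) (xs : List A) (g : B → Tm N) → ∑ (map h xs) g ≈U ∑ xs (g ∘ h)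
  ∑-map h []       g = ≈refl
  ∑-map h (x ∷ xs) g = ⊕-cong ≈refl (∑-map h xs g)

  ∑-comm : ∀ {A B : Set} (xs : List A) (ys : List B) (g : A → B → Tm N) →
    ∑ xs (λ x → ∑ ys (g x)) ≈U ∑ ys (λ y → ∑ xs (λ x → g x y))
  ∑-comm []       ys g = ≈sym (∑-zero ys)
  ∑-comm (x ∷ xs) ys g = ≈trans (⊕-cong ≈refl (∑-comm xs ys g)) (≈sym (∑-⊕ ys _ _))

  ∑-allFin-suc : ∀ n (g : Fin (suc n) → Tm N) → ∑ (allFin (suc n)) g ≈U g zero ⊕ ∑ (allFin n) (g ∘ suc)
  ∑-allFin-suc n g = ⊕-cong ≈refl (≈trans
    (reflexive (cong (λ xs → ∑ xs g) (sym (ListP.map-tabulate id suc))))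
    (∑-map suc (allFin n) g))

  ∑-const : ∀ n (y : Tm N) → ∑ (allFin n) (λ _ → y) ≈U con (+ n / 1) ⊗ y
  ∑-const zero    y = ≈sym (zeroˡ y)
  ∑-const (suc n) y = begin
    ∑ (allFin (suc n)) (λ _ → y)            ≈⟨ ∑-allFin-suc n (λ _ → y) ⟩
    y ⊕ ∑ (allFin n) (λ _ → y)              ≈⟨ ⊕-cong (≈sym (⊗-idˡ y)) (∑-const n y) ⟩
    con 1ℚ ⊗ y ⊕ con (+ n / 1) ⊗ y          ≈⟨ distribʳ _ _ _ ⟨
    (con 1ℚ ⊕ con (+ n / 1)) ⊗ y            ≈⟨ ⊗-cong (con-+ _ _) ≈refl ⟩
    con (1ℚ +ℚ (+ n / 1)) ⊗ y               ≈⟨ reflexive (cong (λ q → con q ⊗ y) ([1+n]/1≡1+n/1 n)) ⟨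
    con (+ suc n / 1) ⊗ y                   ∎

  ∑-δ : ∀ n (c : Fin n) (G : Fin n → Tm N) → ∑ (allFin n) (λ x → con (δ c x) ⊗ G x) ≈U G c
  ∑-δ (suc n) zero G = begin
    ∑ (allFin (suc n)) (λ x → con (δ zero x) ⊗ G x)
      ≈⟨ ∑-allFin-suc n _ ⟩
    con 1ℚ ⊗ G zero ⊕ ∑ (allFin n) (λ x → con 0ℚ ⊗ G (suc x))
      ≈⟨ ⊕-cong (⊗-idˡ _) (∑-cong (allFin n) (λ _ → zeroˡ _)) ⟩
    G zero ⊕ ∑ (allFin n) (λ _ → con 0ℚ)
      ≈⟨ ⊕-cong ≈refl (∑-zero (allFin n)) ⟩
    G zero ⊕ con 0ℚ
      ≈⟨ +-identityʳ _ ⟩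
    G zero
      ∎
  ∑-δ (suc n) (suc c) G = begin
    ∑ (allFin (suc n)) (λ x → con (δ (suc c) x) ⊗ G x)                ≈⟨ ∑-allFin-suc n _ ⟩
    con 0ℚ ⊗ G zero ⊕ ∑ (allFin n) (λ x → con (δ (suc c) (suc x)) ⊗ G (suc x))
      ≈⟨ ⊕-cong (zeroˡ _) (∑-cong (allFin n) (λ x → ⊗-cong (reflexive (cong con (δ-suc c x))) ≈refl)) ⟩
    con 0ℚ ⊕ ∑ (allFin n) (λ x → con (δ c x) ⊗ G (suc x))             ≈⟨ ⊕-idˡ _ ⟩
    ∑ (allFin n) (λ x → con (δ c x) ⊗ G (suc x))                      ≈⟨ ∑-δ n c (G ∘ suc) ⟩
    G (suc c)                                                         ∎

  Idx : ℕ → Set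
  Idx n = Fin n → Fin N

  ∑Idx : ∀ n → (Idx n → Tm N) → Tm N
  ∑Idx n F = ∑ (allIdx n N) F

  Extensional : ∀ {n} → (Idx n → Tm N) → Set
  Extensional F = ∀ {ρ ρ′} → ρ ≗ ρ′ → F ρ ≈U F ρ′

  ∑Idx-suc : ∀ n (F : Idx (suc n) → Tm N) →
    ∑Idx (suc n) F ≈U ∑ (allFin N) (λ x → ∑Idx n (λ ρ → F (x Vector.∷ ρ)))
  ∑Idx-suc n F = ≈trans (∑-concatMap _ (allFin N) F)
    (∑-cong (allFin N) (λ x → ∑-map (x Vector.∷_) (allIdx n N) F))

  ∑Idx-insertAt : ∀ n (v : Fin (suc n)) (F : Idx (suc n) → Tm N) → Extensional F →
    ∑Idx (suc n) F ≈U ∑ (allFin N) (λ x → ∑Idx n (λ ρ → F (insertAt ρ v x)))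
  ∑Idx-insertAt n zero F F-ext = ≈trans (∑Idx-suc n F)
    (∑-cong (allFin N) (λ x → ∑-cong (allIdx n N) (λ ρ → F-ext (∷-cong refl λ _ → refl))))
  ∑Idx-insertAt (suc n) (suc v) F F-ext = begin
    ∑Idx (suc (suc n)) F
      ≈⟨ ∑Idx-suc (suc n) F ⟩
    ∑ (allFin N) (λ y → ∑Idx (suc n) (λ ρ → F (y Vector.∷ ρ)))
      ≈⟨ ∑-cong (allFin N) (λ y → ∑Idx-insertAt n v _ (λ ρ≗ρ′ → F-ext (∷-cong refl ρ≗ρ′))) ⟩
    ∑ (allFin N) (λ y → ∑ (allFin N) (λ x → ∑Idx n (λ ρ → F (y Vector.∷ insertAt ρ v x))))
      ≈⟨ ∑-comm (allFin N) (allFin N) _ ⟩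
    ∑ (allFin N) (λ x → ∑ (allFin N) (λ y → ∑Idx n (λ ρ → F (y Vector.∷ insertAt ρ v x))))
      ≈⟨ ∑-cong (allFin N) (λ x → ≈trans (∑Idx-suc n _) (∑-cong (allFin N) (λ y →
           ∑-cong (allIdx n N) (λ ρ → F-ext (∷-cong refl λ _ → refl))))) ⟨
    ∑ (allFin N) (λ x → ∑Idx (suc n) (λ ρ → F (insertAt ρ (suc v) x)))
      ∎

  ∑Idx-swapAt : ∀ m (p : Fin m) (F : Idx (suc m) → Tm N) → Extensional F →
    ∑Idx (suc m) (λ ρ → F (ρ ∘ swapAt p)) ≈U ∑Idx (suc m) F
  ∑Idx-swapAt (suc m) zero F F-ext = begin
    ∑Idx (suc (suc m)) (λ ρ → F (ρ ∘ swapAt zero))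
      ≈⟨ ≈trans (∑Idx-suc (suc m) _) (∑-cong (allFin N) (λ x → ∑Idx-suc m _)) ⟩
    ∑ (allFin N) (λ x → ∑ (allFin N) (λ y → ∑Idx m (λ ρ → F ((x Vector.∷ (y Vector.∷ ρ)) ∘ swapAt zero))))
      ≈⟨ ∑-cong (allFin N) (λ x → ∑-cong (allFin N) (λ y → ∑-cong (allIdx m N) (λ ρ →
           F-ext (∷-cong refl (∷-cong refl λ _ → refl))))) ⟩
    ∑ (allFin N) (λ x → ∑ (allFin N) (λ y → ∑Idx m (λ ρ → F (y Vector.∷ (x Vector.∷ ρ)))))
      ≈⟨ ∑-comm (allFin N) (allFin N) _ ⟩
    ∑ (allFin N) (λ y → ∑ (allFin N) (λ x → ∑Idx m (λ ρ → F (y Vector.∷ (x Vector.∷ ρ)))))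
      ≈⟨ ≈trans (∑Idx-suc (suc m) F) (∑-cong (allFin N) (λ y → ∑Idx-suc m _)) ⟨
    ∑Idx (suc (suc m)) F
      ∎
  ∑Idx-swapAt (suc m) (suc p) F F-ext = begin
    ∑Idx (suc (suc m)) (λ ρ → F (ρ ∘ swapAt (suc p)))
      ≈⟨ ∑Idx-suc (suc m) _ ⟩
    ∑ (allFin N) (λ x → ∑Idx (suc m) (λ ρ → F ((x Vector.∷ ρ) ∘ swapAt (suc p))))
      ≈⟨ ∑-cong (allFin N) (λ x → ∑-cong (allIdx (suc m) N) (λ ρ → F-ext (∷-cong refl λ _ → refl))) ⟩
    ∑ (allFin N) (λ x → ∑Idx (suc m) (λ ρ → F (x Vector.∷ (ρ ∘ swapAt p))))
      ≈⟨ ∑-cong (allFin N) (λ x → ∑Idx-swapAt m p _ (λ ρ≗ρ′ → F-ext (∷-cong refl ρ≗ρ′))) ⟩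
    ∑ (allFin N) (λ x → ∑Idx (suc m) (λ ρ → F (x Vector.∷ ρ)))
      ≈⟨ ∑Idx-suc (suc m) F ⟨
    ∑Idx (suc (suc m)) F
      ∎

  ∑Idx-++ : ∀ a b (F : Idx (a ℕ.+ b) → Tm N) → Extensional F →
    ∑Idx (a ℕ.+ b) F ≈U ∑Idx a (λ ρ₁ → ∑Idx b (λ ρ₂ → F (ρ₁ Vector.++ ρ₂)))
  ∑Idx-++ zero    b F F-ext = ≈sym (+-identityʳ _)
  ∑Idx-++ (suc a) b F F-ext = begin
    ∑Idx (suc a ℕ.+ b) F
      ≈⟨ ∑Idx-suc (a ℕ.+ b) F ⟩
    ∑ (allFin N) (λ x → ∑Idx (a ℕ.+ b) (λ ρ → F (x Vector.∷ ρ)))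
      ≈⟨ ∑-cong (allFin N) (λ x → ∑Idx-++ a b _ (λ ρ≗ρ′ → F-ext (∷-cong refl ρ≗ρ′))) ⟩
    ∑ (allFin N) (λ x → ∑Idx a (λ ρ₁ → ∑Idx b (λ ρ₂ → F (x Vector.∷ (ρ₁ Vector.++ ρ₂)))))
      ≈⟨ ∑-cong (allFin N) (λ x → ∑-cong (allIdx a N) (λ ρ₁ → ∑-cong (allIdx b N) (λ ρ₂ →
           F-ext (∷-++ x ρ₁ ρ₂)))) ⟩
    ∑ (allFin N) (λ x → ∑Idx a (λ ρ₁ → ∑Idx b (λ ρ₂ → F ((x Vector.∷ ρ₁) Vector.++ ρ₂))))
      ≈⟨ ∑Idx-suc a _ ⟨
    ∑Idx (suc a) (λ ρ₁ → ∑Idx b (λ ρ₂ → F (ρ₁ Vector.++ ρ₂)))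
      ∎
    where
    ∷-++ : ∀ x (ρ₁ : Idx a) (ρ₂ : Idx b) → (x Vector.∷ (ρ₁ Vector.++ ρ₂)) ≗ ((x Vector.∷ ρ₁) Vector.++ ρ₂)
    ∷-++ x ρ₁ ρ₂ zero    = refl
    ∷-++ x ρ₁ ρ₂ (suc i) with Fin.splitAt a i
    ... | inj₁ _ = refl
    ... | inj₂ _ = refl

  prodU-cong : ∀ m {x y : Fin m → Tm N} → (∀ r → x r ≈U y r) → prodU m x ≈U prodU m y
  prodU-cong zero    x≈y = ≈refl
  prodU-cong (suc m) x≈y = ⊗-cong (x≈y zero) (prodU-cong m (x≈y ∘ suc))

  prodU-++ : ∀ a b (x : Fin (a ℕ.+ b) → Tm N) →
    prodU (a ℕ.+ b) x ≈U prodU a (λ i → x (i ↑ˡ b)) ⊗ prodU b (λ s → x (a ↑ʳ s))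
  prodU-++ zero    b x = ≈sym (⊗-idˡ _)
  prodU-++ (suc a) b x = ≈trans (⊗-cong ≈refl (prodU-++ a b (x ∘ suc))) (≈sym (⊗-assoc _ _ _))

  prodU-swapAt : ∀ m (p : Fin m) (x : Fin (suc m) → Tm N) {a b c d} →
    x (inject₁ p) ≡ E a b → x (suc p) ≡ E c d →
    prodU (suc m) x ≈U prodU (suc m) (x ∘ swapAt p) ⊕ con (δ b c) ⊗ prodU m (mergeAt p x (E a d))
                         ⊕ con (- δ d a) ⊗ prodU m (mergeAt p x (E c b))
  prodU-swapAt (suc m) zero x {a} {b} {c} {d} x₀≡ x₁≡ = begin
    x zero ⊗ (x (suc zero) ⊗ R)
      ≈⟨ ⊗-assoc _ _ _ ⟨
    (x zero ⊗ x (suc zero)) ⊗ R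
      ≈⟨ ⊗-cong (⊗-cong (reflexive x₀≡) (reflexive x₁≡)) ≈refl ⟩
    (E a b ⊗ E c d) ⊗ R
      ≈⟨ ⊗-cong (comm-rel a b c d) ≈refl ⟩
    (E c d ⊗ E a b ⊕ con (δ b c) ⊗ E a d ⊕ con (- δ d a) ⊗ E c b) ⊗ R
      ≈⟨ ≈trans (distribʳ _ _ _) (⊕-cong (distribʳ _ _ _) ≈refl) ⟩
    (E c d ⊗ E a b) ⊗ R ⊕ (con (δ b c) ⊗ E a d) ⊗ R ⊕ (con (- δ d a) ⊗ E c b) ⊗ R
      ≈⟨ ⊕-cong (⊕-cong (≈trans (⊗-assoc _ _ _)
                                 (⊗-cong (reflexive (sym x₁≡)) (⊗-cong (reflexive (sym x₀≡)) ≈refl)))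
                         (⊗-assoc _ _ _))
                (⊗-assoc _ _ _) ⟩
    x (suc zero) ⊗ (x zero ⊗ R) ⊕ con (δ b c) ⊗ (E a d ⊗ R) ⊕ con (- δ d a) ⊗ (E c b ⊗ R)
      ∎
    where
    R : Tm N
    R = prodU m (λ r → x (suc (suc r)))
  prodU-swapAt (suc m) (suc p) x {a} {b} {c} {d} xₚ≡ x₁₊ₚ≡ = begin
    x zero ⊗ prodU (suc m) (x ∘ suc)
      ≈⟨ ⊗-cong ≈refl (prodU-swapAt m p (x ∘ suc) xₚ≡ x₁₊ₚ≡) ⟩
    x zero ⊗ (A ⊕ con (δ b c) ⊗ B ⊕ con (- δ d a) ⊗ C)
      ≈⟨ ≈trans (distribˡ _ _ _) (⊕-cong (distribˡ _ _ _) ≈refl) ⟩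
    x zero ⊗ A ⊕ x zero ⊗ (con (δ b c) ⊗ B) ⊕ x zero ⊗ (con (- δ d a) ⊗ C)
      ≈⟨ ⊕-cong (⊕-cong ≈refl (⊗-con-⊗ _ _ _)) (⊗-con-⊗ _ _ _) ⟩
    x zero ⊗ A ⊕ con (δ b c) ⊗ (x zero ⊗ B) ⊕ con (- δ d a) ⊗ (x zero ⊗ C)
      ∎
    where
    A B C : Tm N
    A = prodU (suc m) (λ r → x (suc (swapAt p r)))
    B = prodU m (mergeAt p (x ∘ suc) (E a d))
    C = prodU m (mergeAt p (x ∘ suc) (E c b))

  word : ∀ m → (Fin m → Fin m) → Idx m → Tm N
  word m f ρ = prodU m (λ r → E (ρ r) (ρ (f r)))

  wordSum : ∀ m → (Fin m → Fin m) → Tm N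
  wordSum m f = ∑Idx m (word m f)

  word-extensional : ∀ m f → Extensional (word m f)
  word-extensional m f ρ≗ρ′ = prodU-cong m (λ r → reflexive (cong₂ E (ρ≗ρ′ r) (ρ≗ρ′ (f r))))

  contraction : ∀ m → (Fin (suc m) → Fin (suc m)) → Fin (suc m) → Idx (suc m) → Tm N
  contraction m μ v ρ =
    con (δ (ρ (μ v)) (ρ v)) ⊗ prodU m (λ s → E (ρ (punchIn v s)) (ρ (μ (punchIn v s))))

  contraction-extensional : ∀ m μ v → Extensional (contraction m μ v)
  contraction-extensional m μ v ρ≗ρ′ = ⊗-cong
    (reflexive (cong con (cong₂ δ (ρ≗ρ′ _) (ρ≗ρ′ _))))
    (prodU-cong m (λ s → reflexive (cong₂ E (ρ≗ρ′ _) (ρ≗ρ′ _))))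

  contractionSum : ∀ m → (Fin (suc m) → Fin (suc m)) → Fin (suc m) → Tm N
  contractionSum m μ v = ∑Idx (suc m) (contraction m μ v)

  contractionSum-≢ : ∀ m μ v → v ≢ μ v → contractionSum m μ v ≈U wordSum m (bypass μ v)
  contractionSum-≢ m μ v v≢μv = begin
    contractionSum m μ v
      ≈⟨ ∑Idx-insertAt m v _ (contraction-extensional m μ v) ⟩
    ∑ (allFin N) (λ x → ∑Idx m (λ ρ → contraction m μ v (insertAt ρ v x)))
      ≈⟨ ∑-cong (allFin N) (λ x → ∑-cong (allIdx m N) (λ ρ → ⊗-cong
           (reflexive (cong con (cong₂ δ (insertAt-punchOut ρ v≢μv x) (insertAt-lookup ρ v x))))
           (prodU-cong m (λ s → reflexive (cong (λ z → E z (insertAt ρ v x (μ (punchIn v s))))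
                                                 (insertAt-punchIn ρ v x s)))))) ⟩
    ∑ (allFin N) (λ x → ∑Idx m (λ ρ → con (δ (ρ c) x) ⊗ W ρ x))
      ≈⟨ ∑-comm (allFin N) (allIdx m N) _ ⟩
    ∑Idx m (λ ρ → ∑ (allFin N) (λ x → con (δ (ρ c) x) ⊗ W ρ x))
      ≈⟨ ∑-cong (allIdx m N) (λ ρ → ∑-δ N (ρ c) (W ρ)) ⟩
    ∑Idx m (λ ρ → W ρ (ρ c))
      ≈⟨ ∑-cong (allIdx m N) (λ ρ → prodU-cong m (λ s → reflexive (cong (E (ρ s))
           (insertAt-punchOutOr ρ v (ρ c) _ _ (λ _ → cong ρ (sym (punchOutOr-≢ s v≢μv))))))) ⟩
    wordSum m (bypass μ v)
      ∎
    where
    c : Fin m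
    c = punchOut v≢μv
    W : Idx m → Fin N → Tm N
    W ρ x = prodU m (λ s → E (ρ s) (insertAt ρ v x (μ (punchIn v s))))

  contractionSum-fixed : ∀ m μ v → Injective _≡_ _≡_ μ → v ≡ μ v →
    contractionSum m μ v ≈U con (+ N / 1) ⊗ wordSum m (bypass μ v)
  contractionSum-fixed m μ v μ-inj v≡μv = begin
    contractionSum m μ v
      ≈⟨ ∑Idx-insertAt m v _ (contraction-extensional m μ v) ⟩
    ∑ (allFin N) (λ x → ∑Idx m (λ ρ → contraction m μ v (insertAt ρ v x)))
      ≈⟨ ∑-cong (allFin N) (λ x → ∑-cong (allIdx m N) (λ ρ → ≈trans
           (⊗-cong (reflexive (cong con (δ-at-v ρ x)))
                   (prodU-cong m (λ s → reflexive (cong₂ E (insertAt-punchIn ρ v x s)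
                     (insertAt-punchOutOr ρ v x _ _ (λ v≡ → contradiction v≡ (v≢μ[v↑] s)))))))
           (⊗-idˡ _))) ⟩
    ∑ (allFin N) (λ _ → wordSum m (bypass μ v))
      ≈⟨ ∑-const N _ ⟩
    con (+ N / 1) ⊗ wordSum m (bypass μ v)
      ∎
    where
    δ-at-v : ∀ (ρ : Idx m) x → δ (insertAt ρ v x (μ v)) (insertAt ρ v x v) ≡ 1ℚ
    δ-at-v ρ x = trans (cong (λ z → δ (insertAt ρ v x z) (insertAt ρ v x v)) (sym v≡μv))
                       (δ-refl (insertAt ρ v x v))
    v≢μ[v↑] : ∀ s → v ≢ μ (punchIn v s)
    v≢μ[v↑] s v≡ = FinP.punchInᵢ≢i v s (μ-inj (trans (sym v≡) v≡μv))

  wordSum-swapAt : ∀ m (p : Fin m) (f : Fin (suc m) → Fin (suc m)) →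
    wordSum (suc m) f ≈U wordSum (suc m) (swapAt p ∘ f ∘ swapAt p)
                         ⊕ contractionSum m (f ∘ swapAt p) (suc p)
                         ⊕ con (- 1ℚ) ⊗ contractionSum m (f ∘ swapAt p) (inject₁ p)
  wordSum-swapAt m p f = begin
    wordSum (suc m) f
      ≈⟨ ∑-cong (allIdx (suc m) N) (λ ρ → prodU-swapAt m p (factor ρ) refl refl) ⟩
    ∑Idx (suc m) (λ ρ → A ρ ⊕ B ρ ⊕ C ρ)
      ≈⟨ ≈trans (∑-⊕ (allIdx (suc m) N) _ C) (⊕-cong (∑-⊕ (allIdx (suc m) N) A B) ≈refl) ⟩
    ∑Idx (suc m) A ⊕ ∑Idx (suc m) B ⊕ ∑Idx (suc m) C
      ≈⟨ ⊕-cong (⊕-cong swapped outer) inner ⟩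
    wordSum (suc m) (swapAt p ∘ f ∘ swapAt p) ⊕ contractionSum m (f ∘ swapAt p) (suc p)
      ⊕ con (- 1ℚ) ⊗ contractionSum m (f ∘ swapAt p) (inject₁ p)
      ∎
    where
    factor : Idx (suc m) → Fin (suc m) → Tm N
    factor ρ r = E (ρ r) (ρ (f r))
    A B C : Idx (suc m) → Tm N
    A ρ = prodU (suc m) (factor ρ ∘ swapAt p)
    B ρ = con (δ (ρ (f (inject₁ p))) (ρ (suc p)))
          ⊗ prodU m (mergeAt p (factor ρ) (E (ρ (inject₁ p)) (ρ (f (suc p)))))
    C ρ = con (- δ (ρ (f (suc p))) (ρ (inject₁ p)))
          ⊗ prodU m (mergeAt p (factor ρ) (E (ρ (suc p)) (ρ (f (inject₁ p)))))

    swapped : ∑Idx (suc m) A ≈U wordSum (suc m) (swapAt p ∘ f ∘ swapAt p)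
    swapped = ≈trans
      (∑-cong (allIdx (suc m) N) (λ ρ → prodU-cong (suc m) (λ r →
        reflexive (cong (λ z → E (ρ (swapAt p r)) (ρ z)) (sym (swapAt-involutive p (f (swapAt p r))))))))
      (∑Idx-swapAt m p _ (word-extensional (suc m) (swapAt p ∘ f ∘ swapAt p)))

    swapAt-fixes : ∀ s → s ≢ p → swapAt p (punchIn (suc p) s) ≡ punchIn (suc p) s
    swapAt-fixes s s≢p = swapAt-other p
      (λ eq → s≢p (FinP.punchIn-injective (suc p) s p (trans eq (sym (punchIn-suc-self p)))))
      (FinP.punchInᵢ≢i (suc p) s)

    merged-factor : ∀ ρ v s → s ≢ p → (∀ s → s ≢ p → punchIn v s ≡ punchIn (suc p) s) →
      factor ρ (punchIn (suc p) s) ≡ E (ρ (punchIn v s)) (ρ (f (swapAt p (punchIn v s))))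
    merged-factor ρ v s s≢p v↑≡ rewrite v↑≡ s s≢p | swapAt-fixes s s≢p = refl

    outer : ∑Idx (suc m) B ≈U contractionSum m (f ∘ swapAt p) (suc p)
    outer = ∑-cong (allIdx (suc m) N) (λ ρ → ⊗-cong
      (reflexive (cong (λ z → con (δ (ρ (f z)) (ρ (suc p)))) (sym (swapAt-suc p))))
      (prodU-cong m (λ s → reflexive (mergeAt-≗ p (factor ρ) _ _
        (cong₂ (λ z w → E (ρ z) (ρ (f w))) (sym (punchIn-suc-self p))
               (sym (trans (cong (swapAt p) (punchIn-suc-self p)) (swapAt-inject₁ p))))
        (λ s s≢p → merged-factor ρ (suc p) s s≢p (λ _ _ → refl)) s))))

    inner : ∑Idx (suc m) C ≈U con (- 1ℚ) ⊗ contractionSum m (f ∘ swapAt p) (inject₁ p)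
    inner = ≈trans (∑-cong (allIdx (suc m) N) (λ ρ → ≈trans
      (⊗-cong (reflexive (cong con (sym (-1*x≈-x _)))) ≈refl)
      (≈trans (≈sym (con-⊗-con _ _ _)) (⊗-cong ≈refl (⊗-cong
        (reflexive (cong (λ z → con (δ (ρ (f z)) (ρ (inject₁ p)))) (sym (swapAt-inject₁ p))))
        (prodU-cong m (λ s → reflexive (mergeAt-≗ p (factor ρ) _ _
          (cong₂ (λ z w → E (ρ z) (ρ (f w))) (sym (punchIn-inject₁-self p))
                 (sym (trans (cong (swapAt p) (punchIn-inject₁-self p)) (swapAt-suc p))))
          (λ s s≢p → merged-factor ρ (inject₁ p) s s≢p (punchIn-inject₁≡punchIn-suc p)) s))))))))
      (∑-⊗ˡ (allIdx (suc m) N) (con (- 1ℚ)) _)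

  wordSum-cycle-++ : ∀ k b (f : Fin (suc k ℕ.+ b) → Fin (suc k ℕ.+ b)) (g : Fin b → Fin b) →
    (∀ i → f (i ↑ˡ b) ≡ cyc i ↑ˡ b) → (∀ s → f (suc k ↑ʳ s) ≡ suc k ↑ʳ g s) →
    wordSum (suc k ℕ.+ b) f ≈U casimir N (suc k) ⊗ wordSum b g
  wordSum-cycle-++ k b f g f↑ˡ f↑ʳ = begin
    wordSum (suc k ℕ.+ b) f
      ≈⟨ ∑Idx-++ (suc k) b _ (word-extensional _ f) ⟩
    ∑Idx (suc k) (λ ρ₁ → ∑Idx b (λ ρ₂ → word (suc k ℕ.+ b) f (ρ₁ Vector.++ ρ₂)))
      ≈⟨ ∑-cong (allIdx (suc k) N) (λ ρ₁ → ∑-cong (allIdx b N) (λ ρ₂ → factorise ρ₁ ρ₂)) ⟩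
    ∑Idx (suc k) (λ ρ₁ → ∑Idx b (λ ρ₂ → word (suc k) cyc ρ₁ ⊗ word b g ρ₂))
      ≈⟨ ∑-cong (allIdx (suc k) N) (λ ρ₁ → ∑-⊗ˡ (allIdx b N) (word (suc k) cyc ρ₁) (word b g)) ⟩
    ∑Idx (suc k) (λ ρ₁ → word (suc k) cyc ρ₁ ⊗ wordSum b g)
      ≈⟨ ∑-⊗ʳ (allIdx (suc k) N) (wordSum b g) (word (suc k) cyc) ⟩
    casimir N (suc k) ⊗ wordSum b g
      ∎
    where
    factorise : ∀ ρ₁ ρ₂ → word (suc k ℕ.+ b) f (ρ₁ Vector.++ ρ₂) ≈U word (suc k) cyc ρ₁ ⊗ word b g ρ₂
    factorise ρ₁ ρ₂ = ≈trans (prodU-++ (suc k) b (λ r → E (ρ r) (ρ (f r)))) (⊗-cong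
      (prodU-cong (suc k) (λ i → reflexive (cong₂ E (lookup-++ˡ ρ₁ ρ₂ i)
        (trans (cong ρ (f↑ˡ i)) (lookup-++ˡ ρ₁ ρ₂ (cyc i))))))
      (prodU-cong b (λ s → reflexive (cong₂ E (lookup-++ʳ ρ₁ ρ₂ s)
        (trans (cong ρ (f↑ʳ s)) (lookup-++ʳ ρ₁ ρ₂ (g s)))))))
      where
      ρ : Idx (suc k ℕ.+ b)
      ρ = ρ₁ Vector.++ ρ₂

-- Cycle prefixes

toℕ-cyc : ∀ {k} (i : Fin (suc k)) → toℕ i < k → toℕ (cyc i) ≡ suc (toℕ i)
toℕ-cyc {k} i i<k with suc (toℕ i) ℕ.<? suc k
... | yes i+1<k+1 = FinP.toℕ-fromℕ< i+1<k+1
... | no i+1≮k+1  = contradiction (s≤s i<k) i+1≮k+1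

cyc-last : ∀ {k} (i : Fin (suc k)) → toℕ i ≡ k → cyc i ≡ zero
cyc-last {k} i i≡k with suc (toℕ i) ℕ.<? suc k
... | yes i+1<k+1 = contradiction (ℕ.s≤s⁻¹ i+1<k+1) (ℕP.<-irrefl i≡k)
... | no _        = refl

CyclePrefix : ∀ {m} → ℕ → (Fin m → Fin m) → Set
CyclePrefix k f = ∀ r → toℕ r < k → toℕ (f r) ≡ suc (toℕ r)

module _ {m k} {f : Fin m → Fin m} (f-inj : Injective _≡_ _≡_ f) (pre : CyclePrefix k f) where

  cyclePrefix-pred : ∀ {j} → j < k → ∀ r → toℕ (f r) ≡ suc j → toℕ r ≡ j
  cyclePrefix-pred {j} j<k r f[r]≡1+j = trans (cong toℕ (f-inj (FinP.toℕ-injective (begin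
      toℕ (f r)               ≡⟨ f[r]≡1+j ⟩
      suc j                   ≡⟨ cong suc (FinP.toℕ-fromℕ< j<m) ⟨
      suc (toℕ (fromℕ< j<m))  ≡⟨ pre (fromℕ< j<m) (subst (_< k) (sym (FinP.toℕ-fromℕ< j<m)) j<k) ⟨
      toℕ (f (fromℕ< j<m))    ∎))))
    (FinP.toℕ-fromℕ< j<m)
    where
    open ≡-Reasoning
    j<m : j < m
    j<m = ℕP.<-trans (ℕP.n<1+n j) (subst (_< m) f[r]≡1+j (FinP.toℕ<n (f r)))

  cyclePrefix-next : ∀ {t} (k<m : k < m) → toℕ (f (fromℕ< k<m)) ≡ suc t → k ≤ t
  cyclePrefix-next k<m f[k]≡1+t = ℕP.≮⇒≥ λ t<k →
    ℕP.<-irrefl (trans (sym (cyclePrefix-pred t<k _ f[k]≡1+t)) (FinP.toℕ-fromℕ< k<m)) t<k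

  cyclePrefix-suc : (k<m : k < m) → toℕ (f (fromℕ< k<m)) ≡ suc k → CyclePrefix (suc k) f
  cyclePrefix-suc k<m f[k]≡1+k r r<1+k with ℕP.m≤n⇒m<n∨m≡n (ℕ.s≤s⁻¹ r<1+k)
  ... | inj₁ r<k = pre r r<k
  ... | inj₂ r≡k = trans (cong (toℕ ∘ f) r≡fromℕ<) (trans f[k]≡1+k (cong suc (sym r≡k)))
    where
    r≡fromℕ< : r ≡ fromℕ< k<m
    r≡fromℕ< = FinP.toℕ-injective (trans r≡k (sym (FinP.toℕ-fromℕ< k<m)))

  cycleClosed-preimage : (k<m : k < m) → toℕ (f (fromℕ< k<m)) ≡ 0 → ∀ r → toℕ (f r) ≤ k → toℕ r ≤ k
  cycleClosed-preimage k<m f[k]≡0 r = by-value (toℕ (f r)) refl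
    where
    by-value : ∀ t → toℕ (f r) ≡ t → t ≤ k → toℕ r ≤ k
    by-value zero    f[r]≡0   _     = ℕP.≤-reflexive (trans
      (cong toℕ (f-inj (FinP.toℕ-injective (trans f[r]≡0 (sym f[k]≡0))))) (FinP.toℕ-fromℕ< k<m))
    by-value (suc j) f[r]≡1+j 1+j≤k =
      ℕP.≤-trans (ℕP.≤-reflexive (cyclePrefix-pred 1+j≤k r f[r]≡1+j)) (ℕP.<⇒≤ 1+j≤k)

cyclePrefix-swapAt : ∀ {m k} {f : Fin (suc m) → Fin (suc m)} (k<m : k < suc m) (p : Fin m) → k < toℕ p →
  CyclePrefix k f → f (fromℕ< k<m) ≡ suc p →
  CyclePrefix k (swapAt p ∘ f ∘ swapAt p) × toℕ (swapAt p (f (swapAt p (fromℕ< k<m)))) ≡ toℕ p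
cyclePrefix-swapAt {k = k} {f} k<m p k<p pre f[k]≡1+p = conjugated-prefix , conjugated-next
  where
  fixes : ∀ r → toℕ r ≤ k → swapAt p r ≡ r
  fixes r r≤k = swapAt-below p (ℕP.≤-<-trans r≤k k<p)
  conjugated-prefix : CyclePrefix k (swapAt p ∘ f ∘ swapAt p)
  conjugated-prefix r r<k = trans (cong toℕ (trans (cong (swapAt p ∘ f) (fixes r (ℕP.<⇒≤ r<k)))
    (fixes (f r) (subst (_≤ k) (sym (pre r r<k)) r<k)))) (pre r r<k)
  conjugated-next : toℕ (swapAt p (f (swapAt p (fromℕ< k<m)))) ≡ toℕ p
  conjugated-next = trans (cong toℕ (trans (cong (swapAt p ∘ f) (fixes _ (ℕP.≤-reflexive (FinP.toℕ-fromℕ< k<m))))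
    (trans (cong (swapAt p) f[k]≡1+p) (swapAt-suc p)))) (FinP.toℕ-inject₁ p)

-- Induction on the number of factors

Expressible : ∀ m → (Fin m → Fin m) → Set
Expressible m f = Σ Poly λ P → ∀ N → wordSum {N} m f ≈U evalP N P

ExpressibleBelow : ℕ → Set
ExpressibleBelow m = ∀ {b} → b < m → (g : Fin b → Fin b) → Injective _≡_ _≡_ g → Expressible b g

contractionSum-expressible : ∀ m → ExpressibleBelow (suc m) →
  (μ : Fin (suc m) → Fin (suc m)) → Injective _≡_ _≡_ μ → ∀ v →
  Σ Poly λ Q → ∀ N → contractionSum {N} m μ v ≈U evalP N Q
contractionSum-expressible m IH μ μ-inj v with IH (ℕP.n<1+n m) (bypass μ v) (bypass-injective μ-inj v) | v ≟ μ v
... | P , P-eq | yes v≡μv = varN *P P , λ N →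
  ≈trans (contractionSum-fixed m μ v μ-inj v≡μv) (⊗-cong ≈refl (P-eq N))
... | P , P-eq | no v≢μv  = P , λ N → ≈trans (contractionSum-≢ m μ v v≢μv) (P-eq N)

cycle-expressible : ∀ k b {m} → suc k ℕ.+ b ≡ m → (∀ g → Injective _≡_ _≡_ g → Expressible b g) →
  {f : Fin m → Fin m} → Injective _≡_ _≡_ f → CyclePrefix k f →
  (k<m : k < m) → toℕ (f (fromℕ< k<m)) ≡ 0 → Expressible m f
cycle-expressible k b refl IH {f} f-inj pre k<m f[k]≡0 =
  Data.Product.map (varC k *P_) (λ P-eq N → ≈trans (wordSum-cycle-++ k b f g f↑ˡ f↑ʳ) (⊗-cong ≈refl (P-eq N)))
    (IH g g-inj)
  where
  f↑ˡ : ∀ i → f (i ↑ˡ b) ≡ cyc i ↑ˡ b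
  f↑ˡ i with ℕP.m≤n⇒m<n∨m≡n (ℕ.s≤s⁻¹ (FinP.toℕ<n i))
  ... | inj₁ i<k = FinP.toℕ-injective (begin
    toℕ (f (i ↑ˡ b))     ≡⟨ pre (i ↑ˡ b) (subst (_< k) (sym (FinP.toℕ-↑ˡ i b)) i<k) ⟩
    suc (toℕ (i ↑ˡ b))   ≡⟨ cong suc (FinP.toℕ-↑ˡ i b) ⟩
    suc (toℕ i)          ≡⟨ toℕ-cyc i i<k ⟨
    toℕ (cyc i)          ≡⟨ FinP.toℕ-↑ˡ (cyc i) b ⟨
    toℕ (cyc i ↑ˡ b)     ∎)
    where open ≡-Reasoning
  ... | inj₂ i≡k = FinP.toℕ-injective (begin
    toℕ (f (i ↑ˡ b))        ≡⟨ cong (toℕ ∘ f) (FinP.toℕ-injective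
                                 (trans (FinP.toℕ-↑ˡ i b) (trans i≡k (sym (FinP.toℕ-fromℕ< k<m))))) ⟩
    toℕ (f (fromℕ< k<m))    ≡⟨ f[k]≡0 ⟩
    0                       ≡⟨ cong toℕ (cyc-last i i≡k) ⟨
    toℕ (cyc i)             ≡⟨ FinP.toℕ-↑ˡ (cyc i) b ⟨
    toℕ (cyc i ↑ˡ b)        ∎)
    where open ≡-Reasoning
  beyond-cycle : ∀ s → suc k ≤ toℕ (f (suc k ↑ʳ s))
  beyond-cycle s = ℕP.≮⇒≥ λ f[s]≤k → ℕP.m+n≮m (suc k) (toℕ s)
    (subst (_< suc k) (FinP.toℕ-↑ʳ (suc k) s)
      (s≤s (cycleClosed-preimage f-inj pre k<m f[k]≡0 _ (ℕ.s≤s⁻¹ f[s]≤k))))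
  g : Fin b → Fin b
  g s = Fin.reduce≥ (f (suc k ↑ʳ s)) (beyond-cycle s)
  f↑ʳ : ∀ s → f (suc k ↑ʳ s) ≡ suc k ↑ʳ g s
  f↑ʳ s = sym (FinP.splitAt⁻¹-↑ʳ (FinP.splitAt-≥ (suc k) (f (suc k ↑ʳ s)) (beyond-cycle s)))
  g-inj : Injective _≡_ _≡_ g
  g-inj {s₁} {s₂} eq = FinP.↑ʳ-injective (suc k) s₁ s₂
    (f-inj (trans (f↑ʳ s₁) (trans (cong (suc k ↑ʳ_) eq) (sym (f↑ʳ s₂)))))

module _ (m : ℕ) (IH : ExpressibleBelow (suc m)) where

  swapAt-expressible : ∀ (p : Fin m) (f : Fin (suc m) → Fin (suc m)) → Injective _≡_ _≡_ f →
    Expressible (suc m) (swapAt p ∘ f ∘ swapAt p) → Expressible (suc m) f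
  swapAt-expressible p f f-inj (P , P-eq)
    with contractionSum-expressible m IH (f ∘ swapAt p) (swapAt-injective p ∘ f-inj) (suc p)
       | contractionSum-expressible m IH (f ∘ swapAt p) (swapAt-injective p ∘ f-inj) (inject₁ p)
  ... | Q₁ , Q₁-eq | Q₂ , Q₂-eq = (P +P Q₁) +P (const (- 1ℚ) *P Q₂) , λ N →
    ≈trans (wordSum-swapAt m p f) (⊕-cong (⊕-cong (P-eq N) (Q₁-eq N)) (⊗-cong ≈refl (Q₂-eq N)))

  cyclePrefix⇒expressible : ∀ d k → d ℕ.+ k ≡ suc m → (k<m : k < suc m) (f : Fin (suc m) → Fin (suc m)) →
    Injective _≡_ _≡_ f → CyclePrefix k f → Expressible (suc m) f
  cyclePrefix⇒expressible zero    k k≡1+m k<m _ _ _ = contradiction k<m (ℕP.<-irrefl k≡1+m)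
  cyclePrefix⇒expressible (suc d) k d+k≡ k<m f f-inj pre = byNextValue (toℕ (f (fromℕ< k<m))) f f-inj pre refl
    where
    byNextValue : ∀ t (f : Fin (suc m) → Fin (suc m)) → Injective _≡_ _≡_ f → CyclePrefix k f →
      toℕ (f (fromℕ< k<m)) ≡ t → Expressible (suc m) f
    byNextValue zero    f f-inj pre f[k]≡0 =
      cycle-expressible k (m ∸ k) (ℕP.m+[n∸m]≡n k<m) (IH (s≤s (ℕP.m∸n≤m m k))) f-inj pre k<m f[k]≡0
    byNextValue (suc t) f f-inj pre f[k]≡1+t with ℕP.m≤n⇒m<n∨m≡n (cyclePrefix-next f-inj pre k<m f[k]≡1+t)
    ... | inj₂ k≡t =
      cyclePrefix⇒expressible d (suc k) (trans (ℕP.+-suc d k) d+k≡) 1+k<m f f-inj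
        (cyclePrefix-suc f-inj pre k<m f[k]≡1+k)
      where
      f[k]≡1+k : toℕ (f (fromℕ< k<m)) ≡ suc k
      f[k]≡1+k = trans f[k]≡1+t (cong suc (sym k≡t))
      1+k<m : suc k < suc m
      1+k<m = subst (_< suc m) f[k]≡1+k (FinP.toℕ<n (f (fromℕ< k<m)))
    ... | inj₁ k<t with f (fromℕ< k<m) in f[k]≡
    ...   | suc p = swapAt-expressible p f f-inj
      (byNextValue t _ (swapAt-injective p ∘ f-inj ∘ swapAt-injective p)
        (proj₁ conjugated) (trans (proj₂ conjugated) p≡t))
      where
      p≡t : toℕ p ≡ t
      p≡t = ℕP.suc-injective f[k]≡1+t
      conjugated : CyclePrefix k (swapAt p ∘ f ∘ swapAt p) × toℕ (swapAt p (f (swapAt p (fromℕ< k<m)))) ≡ toℕ p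
      conjugated = cyclePrefix-swapAt k<m p (subst (k <_) (sym p≡t) k<t) pre f[k]≡

injective⇒expressible : ∀ m (f : Fin m → Fin m) → Injective _≡_ _≡_ f → Expressible m f
injective⇒expressible = <-rec (λ m → ∀ f → Injective _≡_ _≡_ f → Expressible m f) step
  where
  step : ∀ m → ExpressibleBelow m → ∀ f → Injective _≡_ _≡_ f → Expressible m f
  step zero    _  f _     = const 1ℚ , λ N → Ring.+-identityʳ (U-ring N) (con 1ℚ)
  step (suc m) IH f f-inj =
    cyclePrefix⇒expressible m IH (suc m) 0 (ℕP.+-identityʳ (suc m)) (s≤s z≤n) f f-inj (λ _ ())

mainTheorem2 : (m : ℕ) (σ : Permutation′ m) →
    Σ Poly (λ P → (N : ℕ) → 1 ≤ N → permSum N m σ ≈U evalP N P)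
mainTheorem2 m σ =
  map₂ (λ P-eq N _ → P-eq N) (injective⇒expressible m (σ ⟨$⟩ʳ_) (Injection.injective (↔⇒↣ σ)))
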